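{- Let $n>k\ge 1$ be coprime integers, and let $[\mu_1,\dots,\mu_t]$ be the continued fraction expansion of $n/k$ given by the Euclidean algorithm, i.e. $\mu_1=q_{ -1},\mu_2=q_0,\dots,\mu_t=q_{i+1}$ in the notation below. Then Smith's construction applied to the sequence $[\mu_1-1,\mu_2,\dots,\mu_t]$ and the Euclidean-algorithm construction applied to $n$ and $k$ (both described below) produce the same cyclic arrangement of the letters $A$ and $B$ on a circle with $n$ spots, up to rotation.
   Context: All arrangements are cyclic (letters written clockwise on a circle), and "between two consecutive symbols" is understood cyclically. Euclidean-algorithm construction on $n>k$. Set $r_{ -3}=n$, $r_{ -2}=k$ and perform the Euclidean algorithm $r_{j-2}=q_j r_{j-1}+r_j$ with $0\le r_j<r_{j-1}$, for $j=-1,0,1,\dots$, stopping at the index $i$ with $r_i\neq 0$ and $r_{i+1}=0$ (so $r_{i-1}=q_{i+1}r_i$); the minimal possible value is $i=-2$. If $i=-2$ (i.e. $k\mid n$), the output is the arrangement with $k$ letters $A$ and exactly $q_{ -1}-1$ letters $B$ between any two cyclically consecutive letters $A$. If $i>-2$, first build a cyclic sequence of symbols $+$ and $-$: (a) place $r_i$ symbols $+$ and put $q_{i+1}-1$ symbols $-$ between any two consecutive $+$ (giving $r_{i-1}$ symbols, $r_i$ of them $+$). Then, for $j=i,i-1,\dots,0$ successively, perform: (b) insert a new symbol $-$ immediately after each existing $+$, and turn every previously existing $-$ into a $+$; (c) between any two consecutive $+$ add $q_j-1$ further symbols $-$. (After the step with index $j$ the sequence has $r_{j-2}$ symbols, $r_{j-1}$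 of which are $+$; in particular the final sequence has $r_{ -2}=k$ symbols, $r_{ -1}$ of which are $+$. If $i=-1$, no steps (b),(c) are performed.) Finally: insert a letter $B$ immediately after each $+$, replace every $+$ and every $-$ by a letter $A$ (giving $k$ letters $A$), and add $q_{ -1}-1$ letters $B$ between any two consecutive letters $A$. The result is a cyclic arrangement of $n$ letters. Smith's construction on a sequence $[\nu_1,\dots,\nu_t]$ (with $\nu_1\ge 0$, $\nu_j\ge1$ for $j\ge2$): define words $S_1=B^{\nu_1}A$, $S_2=S_1^{\nu_2}B$, and $S_j=S_{j-1}^{\nu_j}S_{j-2}$ for $3\le j\le t$, where powers denote repeated concatenation. The output is the word $S_t$ written around a circle. -}

module Defs where

open import Data.Nat using (ℕ; zero; suc; _∸_; NonZero)
open import Data.Nat.DivMod using (_/_; _%_)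
open import Data.List using (List; []; _∷_; _++_; replicate; concatMap; concat; take; drop)
open import Data.Bool using (Bool; true; false)

data Letter : Set where
  A B : Letter

-- A cyclic arrangement is represented by a list read clockwise from some spot;
-- "equal up to rotation" = some cyclic shift of one list equals the other.
rotate : {X : Set} → ℕ → List X → List X
rotate m xs = drop m xs ++ take m xs

-- For (n , k) this is
-- [q₋₁ , q₀ , … , q_{i+1}].  The fuel only guarantees termination; fuel n
-- suffices for n > k (each step strictly decreases the second argument).

euclidQuotients : ℕ → ℕ → ℕ → List ℕ
euclidQuotients zero    a b       = []
euclidQuotients (suc f) a zero    = []
euclidQuotients (suc f) a (suc b) = (a / suc b) ∷ euclidQuotients f (suc b) (a % suc b)

lastNonzeroRem : ℕ → ℕ → ℕ → ℕ
lastNonzeroRem zero    a b       = a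
lastNonzeroRem (suc f) a zero    = a
lastNonzeroRem (suc f) a (suc b) = lastNonzeroRem f (suc b) (a % suc b)

-- Euclidean-algorithm construction.  Symbols: true = "+", false = "-".

stepA : ℕ → ℕ → List Bool
stepA r q = concat (replicate r (true ∷ replicate (q ∸ 1) false))

stepB : List Bool → List Bool
stepB = concatMap (λ { true → true ∷ false ∷ [] ; false → true ∷ [] })

-- step (c): q-1 further - between any two consecutive + (put right after each +;
-- the gap between consecutive + consists only of -, so the position is irrelevant).
stepC : ℕ → List Bool → List Bool
stepC q = concatMap (λ { true → true ∷ replicate (q ∸ 1) false ; false → false ∷ [] })

-- Given r = r_i and [q₀ , … , q_i , q_{i+1}], perform (a) with q_{i+1}, then
-- (b),(c) for j = i , i-1 , … , 0.
plusMinus : ℕ → List ℕ → List Bool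
plusMinus r []             = []
plusMinus r (q ∷ [])       = stepA r q
plusMinus r (q ∷ q' ∷ qs) = stepC q (stepB (plusMinus r (q' ∷ qs)))

toLetters : List Bool → List Letter
toLetters = concatMap (λ { true → A ∷ B ∷ [] ; false → A ∷ [] })

padB : ℕ → List Letter → List Letter
padB q = concatMap (λ { A → A ∷ replicate (q ∸ 1) B ; B → B ∷ [] })

euclidConstruction : ℕ → ℕ → List Letter
euclidConstruction n k with euclidQuotients n n k
... | []          = []
... | q₋₁ ∷ []    = padB q₋₁ (replicate k A)        -- case i = -2
... | q₋₁ ∷ q ∷ qs = padB q₋₁ (toLetters (plusMinus (lastNonzeroRem n n k) (q ∷ qs)))

-- Smith's construction on [ν₁ , … , ν_t]:
-- S₁ = B^ν₁ A, S₂ = S₁^ν₂ B, S_j = S_{j-1}^ν_j S_{j-2}.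
-- (Implemented by iterating the pair (S_{j-2}, S_{j-1}) starting from (B , S₁);
--  S₂ = S₁^ν₂ B is exactly the j = 2 step with this B.)

power : {X : Set} → ℕ → List X → List X
power m w = concat (replicate m w)

smithGo : List Letter → List Letter → List ℕ → List Letter
smithGo prev cur []       = cur
smithGo prev cur (ν ∷ νs) = smithGo cur (power ν cur ++ prev) νs

smith : List ℕ → List Letter
smith []        = []
smith (ν₁ ∷ νs) = smithGo (B ∷ []) (replicate ν₁ B ++ A ∷ []) νs

smithInput : ℕ → ℕ → List ℕ
smithInput n k with euclidQuotients n n k
... | []      = []
... | μ₁ ∷ μs = (μ₁ ∸ 1) ∷ μs

{-# OPTIONS --safe #-}
module Submission where

-- Write X, Y for the words that the final substitution (+ ↦ A B^{μ₁-1} B, − ↦ A B^{μ₁-1})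
-- makes of the symbols + and −.  Peeling off the outermost steps (b),(c) of the Euclidean
-- construction, with quotient q, replaces (X, Y) by (X Y^q, X Y^{q-1}), while Smith's
-- recursion replaces (S_{j-2}, S_{j-1}) by (S_{j-1}, S_{j-1}^q S_{j-2}).  If one word P
-- satisfies P X = S_{j-1} S_{j-2} P and P Y = S_{j-1} P, then S_{j-1}^{q-1} P satisfies the
-- same two relations for the new pairs.  Coprimality gives r_i = 1, so the innermost
-- sequence is a single + followed by −'s, whose image is conjugate to S_t; and conjugate
-- words are rotations of each other.

open import Defs
open import Data.Bool using (Bool; true; false)
open import Data.List using (List; []; _∷_; _++_; [_]; _∷ʳ_; replicate; concatMap; take; drop; length; initLast; _∷ʳ′_)
open import Data.List.Properties using (++-assoc; ++-identityʳ; ++-cancelˡ; concatMap-++; ∷-injective; ∷ʳ-injective)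
open import Data.List.Relation.Unary.All using (All; []; _∷_)
open import Data.Nat using (ℕ; zero; suc; _∸_; _≤_; _<_; s≤s)
open import Data.Nat.Coprimality using (Coprime)
open import Data.Nat.DivMod using (_/_; _%_; m%n<n; m≥n⇒m/n>0)
open import Data.Nat.Divisibility using (_∣_; ∣-refl; _∣0; m%n≡0⇒n∣m; ∣n∣m%n⇒∣m)
open import Data.Nat.Properties using (≤-trans; ≤-pred; <⇒≤)
open import Data.Product using (∃; ∃₂; _×_; _,_; proj₂)
open import Function using (_$_)
open import Relation.Binary.PropositionalEquality using (_≡_; refl; sym; trans; cong; subst; module ≡-Reasoning)
open ≡-Reasoning

private variable
  L : Set
  P Q S S′ S₀ S₁ T X X′ Y Z : List L

drop-length-++ : (u v : List L) → drop (length u) (u ++ v) ≡ v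
drop-length-++ []      v = refl
drop-length-++ (x ∷ u) v = drop-length-++ u v

take-length-++ : (u v : List L) → take (length u) (u ++ v) ≡ u
take-length-++ []      v = refl
take-length-++ (x ∷ u) v = cong (x ∷_) (take-length-++ u v)

rotate-length-++ : (u v : List L) → rotate (length u) (u ++ v) ≡ v ++ u
rotate-length-++ u v rewrite drop-length-++ u v | take-length-++ u v = refl

record Conjugates (P X S : List L) : Set where
  constructor conjugating
  field
    conjugation : P ++ X ≡ S ++ P

conjugates-resp : X ≡ X′ → S ≡ S′ → Conjugates P X S → Conjugates P X′ S′
conjugates-resp refl refl c = c

conjugates⇒split : Conjugates Q X S → ∃₂ λ u v → S ≡ u ++ v × X ≡ v ++ u
conjugates⇒split {Q = []} {S = S} (conjugating c) = [] , S , refl , c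
conjugates⇒split {Q = x ∷ Q} {X = X} {S = []} (conjugating c) =
  [] , [] , refl , ++-cancelˡ (x ∷ Q) X [] (trans c (sym (++-identityʳ (x ∷ Q))))
-- The first letter of Q is also that of S; moving it to the end of S leaves an equation of
-- the same shape with Q one letter shorter.
conjugates⇒split {Q = x ∷ Q} {S = s ∷ S} (conjugating c) with refl , c′ ← ∷-injective c
  with u , v , S∷ʳx≡uv , X≡vu ← conjugates⇒split (conjugating (trans c′ (sym (++-assoc S [ x ] Q))))
  with initLast v
... | [] = [ x ] , S , refl , trans X≡vu (trans (sym (++-identityʳ u)) (sym S∷ʳx≡uv))
... | v′ ∷ʳ′ y with S≡uv′ , refl ← ∷ʳ-injective S (u ++ v′) (trans S∷ʳx≡uv (sym (++-assoc u v′ [ y ])))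
  = x ∷ u , v′ , cong (x ∷_) S≡uv′ , trans X≡vu (++-assoc v′ [ x ] u)

conjugates⇒rotation : Conjugates Q X S → ∃ λ m → rotate m S ≡ X
conjugates⇒rotation c with u , v , refl , refl ← conjugates⇒split c = length u , rotate-length-++ u v

conjugates-++ : Conjugates P X S → Conjugates P Y T → Conjugates P (X ++ Y) (S ++ T)
conjugates-++ {P = P} {X} {S} {Y} {T} (conjugating cX) (conjugating cY) = conjugating $ begin
  P ++ (X ++ Y)   ≡⟨ sym (++-assoc P X Y) ⟩
  (P ++ X) ++ Y   ≡⟨ cong (_++ Y) cX ⟩
  (S ++ P) ++ Y   ≡⟨ ++-assoc S P Y ⟩
  S ++ (P ++ Y)   ≡⟨ cong (S ++_) cY ⟩
  S ++ (T ++ P)   ≡⟨ sym (++-assoc S T P) ⟩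
  (S ++ T) ++ P   ∎

conjugates-power : (j : ℕ) → Conjugates P Y S → Conjugates P (power j Y) (power j S)
conjugates-power {P = P} zero    c = conjugating (++-identityʳ P)
conjugates-power         (suc j) c = conjugates-++ c (conjugates-power j c)

conjugates-trans : Conjugates P X S → Conjugates Z S T → Conjugates (Z ++ P) X T
conjugates-trans {P = P} {X} {S} {Z} {T} (conjugating cP) (conjugating cZ) = conjugating $ begin
  (Z ++ P) ++ X   ≡⟨ ++-assoc Z P X ⟩
  Z ++ (P ++ X)   ≡⟨ cong (Z ++_) cP ⟩
  Z ++ (S ++ P)   ≡⟨ sym (++-assoc Z S P) ⟩
  (Z ++ S) ++ P   ≡⟨ cong (_++ P) cZ ⟩
  (T ++ Z) ++ P   ≡⟨ ++-assoc T Z P ⟩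
  T ++ (Z ++ P)   ∎

rotation-conjugates : (U V : List L) → Conjugates U (V ++ U) (U ++ V)
rotation-conjugates U V = conjugating (sym (++-assoc U V U))

conjugates-absorb : (Z U : List L) → Conjugates P X (U ++ Z) → Conjugates (Z ++ P) X (Z ++ U)
conjugates-absorb Z U c = conjugates-trans c (rotation-conjugates Z U)

power-comm : (p : ℕ) (W : List L) → power p W ++ W ≡ W ++ power p W
power-comm zero    W = sym (++-identityʳ W)
power-comm (suc p) W = begin
  (W ++ power p W) ++ W   ≡⟨ ++-assoc W (power p W) W ⟩
  W ++ (power p W ++ W)   ≡⟨ cong (W ++_) (power-comm p W) ⟩
  W ++ (W ++ power p W)   ∎

power-suc-++ : (p : ℕ) (W V : List L) → power p W ++ (W ++ V) ≡ power (suc p) W ++ V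
power-suc-++ p W V = begin
  power p W ++ (W ++ V)   ≡⟨ sym (++-assoc (power p W) W V) ⟩
  (power p W ++ W) ++ V   ≡⟨ cong (_++ V) (power-comm p W) ⟩
  power (suc p) W ++ V    ∎

substitute : List L → List L → List Bool → List L
substitute X Y = concatMap λ { true → X ; false → Y }

substitute-replicate-false : (p : ℕ) → substitute X Y (replicate p false) ≡ power p Y
substitute-replicate-false zero    = refl
substitute-replicate-false {Y = Y} (suc p) = cong (Y ++_) (substitute-replicate-false p)

substitute-plus-run : (p : ℕ) (w : List Bool) →
  substitute X Y ((true ∷ replicate p false) ++ w) ≡ (X ++ power p Y) ++ substitute X Y w
substitute-plus-run {X = X} {Y} p w = begin
  substitute X Y ((true ∷ replicate p false) ++ w)
    ≡⟨ concatMap-++ _ (true ∷ replicate p false) w ⟩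
  (X ++ substitute X Y (replicate p false)) ++ substitute X Y w
    ≡⟨ cong (λ R → (X ++ R) ++ substitute X Y w) (substitute-replicate-false p) ⟩
  (X ++ power p Y) ++ substitute X Y w ∎

substitute-stepA : (p : ℕ) → substitute X Y (stepA 1 (suc p)) ≡ X ++ power p Y
substitute-stepA {X = X} {Y} p = begin
  substitute X Y ((true ∷ replicate p false) ++ [])   ≡⟨ substitute-plus-run p [] ⟩
  (X ++ power p Y) ++ []                            ≡⟨ ++-identityʳ _ ⟩
  X ++ power p Y                                    ∎

substitute-stepC-stepB : (p : ℕ) (w : List Bool) →
  substitute X Y (stepC (suc p) (stepB w)) ≡ substitute (X ++ power (suc p) Y) (X ++ power p Y) w
substitute-stepC-stepB p [] = refl
substitute-stepC-stepB {L} {X} {Y} p (true ∷ w) = begin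
  substitute X Y ((true ∷ replicate p false) ++ (false ∷ stepC (suc p) (stepB w)))
    ≡⟨ substitute-plus-run p _ ⟩
  (X ++ power p Y) ++ (Y ++ substitute X Y (stepC (suc p) (stepB w)))
    ≡⟨ cong (λ R → (X ++ power p Y) ++ (Y ++ R)) (substitute-stepC-stepB p w) ⟩
  (X ++ power p Y) ++ (Y ++ R)
    ≡⟨ ++-assoc X (power p Y) (Y ++ R) ⟩
  X ++ (power p Y ++ (Y ++ R))
    ≡⟨ cong (X ++_) (power-suc-++ p Y R) ⟩
  X ++ (power (suc p) Y ++ R)
    ≡⟨ sym (++-assoc X (power (suc p) Y) R) ⟩
  (X ++ power (suc p) Y) ++ R ∎
  where
  R : List L
  R = substitute (X ++ power (suc p) Y) (X ++ power p Y) w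
substitute-stepC-stepB {X = X} {Y} p (false ∷ w) = begin
  substitute X Y ((true ∷ replicate p false) ++ stepC (suc p) (stepB w))
    ≡⟨ substitute-plus-run p _ ⟩
  (X ++ power p Y) ++ substitute X Y (stepC (suc p) (stepB w))
    ≡⟨ cong ((X ++ power p Y) ++_) (substitute-stepC-stepB p w) ⟩
  (X ++ power p Y) ++ substitute (X ++ power (suc p) Y) (X ++ power p Y) w ∎

padB-toLetters : (μ : ℕ) (w : List Bool) →
  padB μ (toLetters w) ≡ substitute ((A ∷ replicate (μ ∸ 1) B) ∷ʳ B) (A ∷ replicate (μ ∸ 1) B) w
padB-toLetters μ [] = refl
padB-toLetters μ (true ∷ w) = trans
  (cong ((A ∷ replicate (μ ∸ 1) B) ++_) (cong (B ∷_) (padB-toLetters μ w)))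
  (sym (++-assoc (A ∷ replicate (μ ∸ 1) B) [ B ] _))
padB-toLetters μ (false ∷ w) = cong ((A ∷ replicate (μ ∸ 1) B) ++_) (padB-toLetters μ w)

-- (S₀ , S₁) is Smith's pair (S_{j-2} , S_{j-1}); X and Y are the current images of + and −.
record Tracks (P X Y S₀ S₁ : List L) : Set where
  field
    plus  : Conjugates P X (S₁ ++ S₀)
    minus : Conjugates P Y S₁

tracks-step : (p : ℕ) → Tracks P X Y S₀ S₁ →
  Tracks (power p S₁ ++ P) (X ++ power (suc p) Y) (X ++ power p Y) S₁ (power (suc p) S₁ ++ S₀)
tracks-step {L} {S₀ = S₀} {S₁ = S₁} p t = record
  { plus  = conjugates-resp refl (trans (sym (++-assoc Sᵖ (S₁ ++ S₀) S₁)) (cong (_++ S₁) (power-suc-++ p S₁ S₀)))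
              (conjugates-absorb Sᵖ ((S₁ ++ S₀) ++ S₁)
                (conjugates-resp refl (sym (++-assoc (S₁ ++ S₀) S₁ Sᵖ))
                  (conjugates-++ plus (conjugates-power (suc p) minus))))
  ; minus = conjugates-resp refl (power-suc-++ p S₁ S₀)
              (conjugates-absorb Sᵖ (S₁ ++ S₀) (conjugates-++ plus (conjugates-power p minus)))
  }
  where
  open Tracks t
  Sᵖ : List L
  Sᵖ = power p S₁

replicate-∷ʳ : (m : ℕ) (x : L) → replicate m x ∷ʳ x ≡ x ∷ replicate m x
replicate-∷ʳ zero    x = refl
replicate-∷ʳ (suc m) x = cong (x ∷_) (replicate-∷ʳ m x)

tracks-start : (μ : ℕ) → let Bs = replicate (μ ∸ 1) B in
  Tracks Bs ((A ∷ Bs) ∷ʳ B) (A ∷ Bs) [ B ] (Bs ∷ʳ A)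
tracks-start μ = record
  { plus  = conjugates-resp (cong (A ∷_) (sym (replicate-∷ʳ (μ ∸ 1) B))) (sym (++-assoc Bs [ A ] [ B ]))
              (rotation-conjugates Bs (A ∷ B ∷ []))
  ; minus = rotation-conjugates Bs [ A ]
  }
  where
  Bs : List Letter
  Bs = replicate (μ ∸ 1) B

plusMinus-conjugates-smithGo : (q : ℕ) (qs : List ℕ) → All (1 ≤_) (q ∷ qs) → Tracks P X Y S₀ S₁ →
  ∃ λ Q → Conjugates Q (substitute X Y (plusMinus 1 (q ∷ qs))) (smithGo S₀ S₁ (q ∷ qs))
plusMinus-conjugates-smithGo zero _ (() ∷ _) _
plusMinus-conjugates-smithGo (suc p) [] _ t =
  _ , conjugates-resp (sym (substitute-stepA p)) refl (Tracks.minus (tracks-step p t))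
plusMinus-conjugates-smithGo (suc p) (q ∷ qs) (_ ∷ positive) t
  with Q , c ← plusMinus-conjugates-smithGo q qs positive (tracks-step p t)
  = Q , conjugates-resp (sym (substitute-stepC-stepB p (plusMinus 1 (q ∷ qs)))) refl c

padB-plusMinus-conjugates-smith : (μ q : ℕ) (qs : List ℕ) → All (1 ≤_) (q ∷ qs) →
  ∃ λ Q → Conjugates Q (padB μ (toLetters (plusMinus 1 (q ∷ qs)))) (smith ((μ ∸ 1) ∷ q ∷ qs))
padB-plusMinus-conjugates-smith μ q qs positive
  with Q , c ← plusMinus-conjugates-smithGo q qs positive (tracks-start μ)
  = Q , conjugates-resp (sym (padB-toLetters μ (plusMinus 1 (q ∷ qs)))) refl c

euclidQuotients-positive : (f a b : ℕ) → b ≤ a → All (1 ≤_) (euclidQuotients f a b)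
euclidQuotients-positive zero    a b       _   = []
euclidQuotients-positive (suc f) a zero    _   = []
euclidQuotients-positive (suc f) a (suc b) b≤a =
  m≥n⇒m/n>0 b≤a ∷ euclidQuotients-positive f (suc b) (a % suc b) (<⇒≤ (m%n<n a (suc b)))

euclidQuotients-suc≡[] : {f a b : ℕ} → euclidQuotients (suc f) a b ≡ [] → b ≡ 0
euclidQuotients-suc≡[] {b = zero} _ = refl

lastNonzeroRem-∣ : (f a b : ℕ) → b ≤ f → lastNonzeroRem f a b ∣ a × lastNonzeroRem f a b ∣ b
lastNonzeroRem-∣ zero    a zero    _ = ∣-refl , a ∣0
lastNonzeroRem-∣ (suc f) a zero    _ = ∣-refl , a ∣0
lastNonzeroRem-∣ (suc f) a (suc b) (s≤s b≤f)
  with d∣b , d∣a%b ← lastNonzeroRem-∣ f (suc b) (a % suc b) (≤-trans (≤-pred (m%n<n a (suc b))) b≤f)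
  = ∣n∣m%n⇒∣m d∣b d∣a%b , d∣b

proposition3p4 : (n k : ℕ) → 1 ≤ k → k < n → Coprime n k →
    ∃ λ m → rotate m (smith (smithInput n k)) ≡ euclidConstruction n k
proposition3p4 zero    _       _ ()        _
proposition3p4 (suc _) zero    () _        _
proposition3p4 1       (suc _) _  (s≤s ()) _
proposition3p4 n@(suc (suc f)) k@(suc _) _ k<n coprime with euclidQuotients (suc f) k (n % k) in quotients
... | [] with refl ← coprime (m%n≡0⇒n∣m n k (euclidQuotients-suc≡[] quotients) , ∣-refl)
  = length Bs , trans (rotate-length-++ Bs [ A ]) (sym (++-identityʳ (A ∷ Bs)))
  where
  Bs : List Letter
  Bs = replicate (n / 1 ∸ 1) B
... | q ∷ qs rewrite coprime (lastNonzeroRem-∣ n n k (<⇒≤ k<n)) =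
  conjugates⇒rotation (proj₂ (padB-plusMinus-conjugates-smith (n / k) q qs positive))
  where
  positive : All (1 ≤_) (q ∷ qs)
  positive = subst (All (1 ≤_)) quotients (euclidQuotients-positive (suc f) k (n % k) (<⇒≤ (m%n<n n k)))
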